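{- Let $A=\begin{pmatrix} a & b\\ c & d\end{pmatrix}\in\mathrm{M}_2(\mathbb{Q})$ with $b\neq 0$, whose characteristic polynomial $p_A(x)=x^2-Px+Q$ has integer coefficients, where $P=\operatorname{tr}A$ and $Q=\det A\neq 0$. Let $U_n=U_n(P,Q)$ be the Lucas sequence. Then \[ \mathcal{S}(A)=\mathcal{L}(P,Q,a)\cap\mathcal{L}(P,Q,b)\cap\mathcal{L}\big(P,Q,\tfrac{p_A(a)}{b}\big). \]
   Context: $\mathbb{N}=\{0,1,2,\ldots\}$. For $P,Q\in\mathbb{Z}$, the Lucas sequence $U_n=U_n(P,Q)$ is defined by $U_0=0$, $U_1=1$, $U_{n}=PU_{n-1}-QU_{n-2}$. For $R\in\mathbb{Q}$, $\mathcal{L}(P,Q,R)=\{n\in\mathbb{N} : U_nR\in\mathbb{Z}\}$. For $A\in\mathrm{M}_d(\mathbb{Q})$, $\mathcal{S}(A)=\{n\in\mathbb{N}: A^n\in\mathrm{M}_d(\mathbb{Z})\}$. -}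

module Defs where

open import Data.Nat using (ℕ; zero; suc)
open import Data.Integer as ℤ using (ℤ)
open import Data.Rational as ℚ using (ℚ; _/_)
open import Data.Fin using (Fin; zero; suc)
open import Data.Product using (∃)
open import Relation.Binary.PropositionalEquality using (_≡_)

IsIntegral : ℚ → Set
IsIntegral q = ∃ λ (z : ℤ) → q ≡ z / 1

U : ℤ → ℤ → ℕ → ℤ
U P Q zero = ℤ.0ℤ
U P Q (suc zero) = ℤ.1ℤ
U P Q (suc (suc n)) = P ℤ.* U P Q (suc n) ℤ.- Q ℤ.* U P Q n

𝓛 : ℤ → ℤ → ℚ → ℕ → Set
𝓛 P Q R n = IsIntegral (ℚ._*_ (U P Q n / 1) R)

Mat : ℕ → Set
Mat d = Fin d → Fin d → ℚ

sumFin : (d : ℕ) → (Fin d → ℚ) → ℚ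
sumFin zero f = ℚ.0ℚ
sumFin (suc d) f = f zero ℚ.+ sumFin d (λ i → f (suc i))

identity : (d : ℕ) → Mat d
identity d zero zero = ℚ.1ℚ
identity d zero (suc j) = ℚ.0ℚ
identity d (suc i) zero = ℚ.0ℚ
identity (suc d) (suc i) (suc j) = identity d i j

mul : {d : ℕ} → Mat d → Mat d → Mat d
mul {d} A B i j = sumFin d (λ k → A i k ℚ.* B k j)

pow : {d : ℕ} → Mat d → ℕ → Mat d
pow {d} A zero = identity d
pow A (suc n) = mul (pow A n) A

𝓢 : {d : ℕ} → Mat d → ℕ → Set
𝓢 A n = ∀ i j → IsIntegral (pow A n i j)

mat2 : ℚ → ℚ → ℚ → ℚ → Mat 2
mat2 a b c d zero zero = a
mat2 a b c d zero (suc zero) = b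
mat2 a b c d (suc zero) zero = c
mat2 a b c d (suc zero) (suc zero) = d

-- A 2×2 matrix A satisfies its characteristic polynomial, A² = P A − Q I, so an
-- induction on n gives A^(n+1) = U_(n+1) A − Q U_n I, whose entries are
-- U_(n+1) a − Q U_n, U_(n+1) b, U_(n+1) c and U_(n+1) d − Q U_n. Since Q U_n and
-- P U_(n+1) are integers, A^(n+1) is integral exactly when U_(n+1) a, U_(n+1) b and
-- U_(n+1) c are, and p_A(a)/b = −c because p_A(a) = a² − (a + d) a + ad − bc = −bc.
module Submission where

open import Defs
open import Data.Nat using (ℕ; zero; suc)
open import Data.Integer using (ℤ; 0ℤ)
import Data.Integer as ℤ
import Data.Integer.Properties as ℤₚ
open import Data.Rational using (ℚ; _+_; _-_; _*_; _÷_; _/_; NonZero; -_; 0ℚ; 1ℚ; mkℚ; 1/_)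
import Data.Rational.Properties as ℚₚ
open import Data.Rational.Solver using (module +-*-Solver)
open import Data.Nat.Coprimality using (1-coprimeTo) renaming (sym to coprime-sym)
open import Data.Fin using (Fin; zero; suc)
open import Data.Product using (_×_; _,_)
open import Data.Product.Function.NonDependent.Propositional using (_×-⇔_)
open import Function using (_∘_)
open import Function.Bundles using (_⇔_; mk⇔)
import Function.Properties.Equivalence as ⇔
open import Relation.Binary.PropositionalEquality
  using (_≡_; _≢_; refl; sym; trans; cong; cong₂; subst; module ≡-Reasoning)

open +-*-Solver
open ≡-Reasoning

ι : ℤ → ℚ
ι z = z / 1

-- On this normal form _+_ and _*_ compute, which makes ι a ring homomorphism.
ι≡mkℚ : ∀ z → ι z ≡ mkℚ z 0 (coprime-sym (1-coprimeTo _))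
ι≡mkℚ z = ℚₚ.↥p/↧p≡p (mkℚ z 0 (coprime-sym (1-coprimeTo _)))

ι-homo-+ : ∀ x y → ι (x ℤ.+ y) ≡ ι x + ι y
ι-homo-+ x y = sym (trans (cong₂ _+_ (ι≡mkℚ x) (ι≡mkℚ y))
  (ℚₚ./-cong (cong₂ ℤ._+_ (ℤₚ.*-identityʳ x) (ℤₚ.*-identityʳ y)) refl))

ι-homo-* : ∀ x y → ι (x ℤ.* y) ≡ ι x * ι y
ι-homo-* x y = sym (cong₂ _*_ (ι≡mkℚ x) (ι≡mkℚ y))

ι-homo-neg : ∀ x → ι (ℤ.- x) ≡ - ι x
ι-homo-neg x = begin
  ι (ℤ.- x)              ≡⟨ cong ι (sym (ℤₚ.-1*i≡-i x)) ⟩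
  ι (ℤ.-1ℤ ℤ.* x)        ≡⟨ ι-homo-* ℤ.-1ℤ x ⟩
  - 1ℚ * ι x             ≡⟨ solve 1 (λ y → (:- con 1ℚ) :* y := :- y) refl (ι x) ⟩
  - ι x                  ∎

ι-homo-- : ∀ x y → ι (x ℤ.- y) ≡ ι x - ι y
ι-homo-- x y = trans (ι-homo-+ x (ℤ.- y)) (cong (ι x +_) (ι-homo-neg y))

U-rec : ∀ P Q k →
  ι (U P Q (suc (suc k))) ≡ ι P * ι (U P Q (suc k)) - ι Q * ι (U P Q k)
U-rec P Q k = trans (ι-homo-- (P ℤ.* U P Q (suc k)) (Q ℤ.* U P Q k))
  (cong₂ _-_ (ι-homo-* P _) (ι-homo-* Q _))

IsIntegral-ι : ∀ z → IsIntegral (ι z)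
IsIntegral-ι z = z , refl

IsIntegral-+ : ∀ {x y} → IsIntegral x → IsIntegral y → IsIntegral (x + y)
IsIntegral-+ (z , refl) (w , refl) = z ℤ.+ w , sym (ι-homo-+ z w)

IsIntegral-* : ∀ {x y} → IsIntegral x → IsIntegral y → IsIntegral (x * y)
IsIntegral-* (z , refl) (w , refl) = z ℤ.* w , sym (ι-homo-* z w)

IsIntegral-neg : ∀ {x} → IsIntegral x → IsIntegral (- x)
IsIntegral-neg (z , refl) = ℤ.- z , sym (ι-homo-neg z)

IsIntegral-- : ∀ {x y} → IsIntegral x → IsIntegral y → IsIntegral (x - y)
IsIntegral-- i j = IsIntegral-+ i (IsIntegral-neg j)

IsIntegral-neg⇔ : ∀ x → IsIntegral (- x) ⇔ IsIntegral x
IsIntegral-neg⇔ x = mk⇔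
  (subst IsIntegral (solve 1 (λ y → :- (:- y) := y) refl x) ∘ IsIntegral-neg) IsIntegral-neg

IsIntegral-identity : ∀ d i j → IsIntegral (identity d i j)
IsIntegral-identity d zero zero = IsIntegral-ι (ℤ.+ 1)
IsIntegral-identity d zero (suc j) = IsIntegral-ι 0ℤ
IsIntegral-identity d (suc i) zero = IsIntegral-ι 0ℤ
IsIntegral-identity (suc d) (suc i) (suc j) = IsIntegral-identity d i j

IsIntegral-entrywise-cong : ∀ {d} {A B : Mat d} → (∀ i j → A i j ≡ B i j) →
  (∀ i j → IsIntegral (A i j)) ⇔ (∀ i j → IsIntegral (B i j))
IsIntegral-entrywise-cong A≡B = mk⇔
  (λ intA i j → subst IsIntegral (A≡B i j) (intA i j))
  (λ intB i j → subst IsIntegral (sym (A≡B i j)) (intB i j))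

𝓛-zero : ∀ P Q R → 𝓛 P Q R 0
𝓛-zero P Q R = 0ℤ , ℚₚ.*-zeroˡ R

𝓛-neg⇔ : ∀ P Q R n → 𝓛 P Q (- R) n ⇔ 𝓛 P Q R n
𝓛-neg⇔ P Q R n = subst (λ x → IsIntegral x ⇔ 𝓛 P Q R n)
  (ℚₚ.neg-distribʳ-* (ι (U P Q n)) R) (IsIntegral-neg⇔ (ι (U P Q n) * R))

sumFin-cong : ∀ d {f g : Fin d → ℚ} → (∀ k → f k ≡ g k) → sumFin d f ≡ sumFin d g
sumFin-cong zero f≡g = refl
sumFin-cong (suc d) f≡g = cong₂ _+_ (f≡g zero) (sumFin-cong d (f≡g ∘ suc))

mul-congˡ : ∀ {d} {B C : Mat d} (A : Mat d) → (∀ i j → B i j ≡ C i j) →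
  ∀ i j → mul B A i j ≡ mul C A i j
mul-congˡ {d} A B≡C i j = sumFin-cong d (λ k → cong (_* A k j) (B≡C i k))

module _ (a b c d : ℚ) where

  pencil : ℚ → ℚ → Mat 2
  pencil v s = mat2 (v * a - s) (v * b) (v * c) (v * d - s)

  pow-mat2-one : ∀ i j → pow (mat2 a b c d) 1 i j ≡ pencil 1ℚ 0ℚ i j
  pow-mat2-one zero zero = solve 2 (λ a c →
    con 1ℚ :* a :+ (con 0ℚ :* c :+ con 0ℚ) := con 1ℚ :* a :- con 0ℚ) refl a c
  pow-mat2-one zero (suc zero) = solve 2 (λ b d →
    con 1ℚ :* b :+ (con 0ℚ :* d :+ con 0ℚ) := con 1ℚ :* b) refl b d
  pow-mat2-one (suc zero) zero = solve 2 (λ a c →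
    con 0ℚ :* a :+ (con 1ℚ :* c :+ con 0ℚ) := con 1ℚ :* c) refl a c
  pow-mat2-one (suc zero) (suc zero) = solve 2 (λ b d →
    con 0ℚ :* b :+ (con 1ℚ :* d :+ con 0ℚ) := con 1ℚ :* d :- con 0ℚ) refl b d

  -- Cayley–Hamilton: A² = (a + d) A − (ad − bc) I.
  pencil-mul : ∀ v s i j → mul (pencil v s) (mat2 a b c d) i j ≡
    pencil ((a + d) * v - s) ((a * d - b * c) * v) i j
  pencil-mul v s zero zero = solve 6 (λ a b c d v s →
    (v :* a :- s) :* a :+ (v :* b :* c :+ con 0ℚ)
      := ((a :+ d) :* v :- s) :* a :- (a :* d :- b :* c) :* v) refl a b c d v s
  pencil-mul v s zero (suc zero) = solve 6 (λ a b c d v s →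
    (v :* a :- s) :* b :+ (v :* b :* d :+ con 0ℚ)
      := ((a :+ d) :* v :- s) :* b) refl a b c d v s
  pencil-mul v s (suc zero) zero = solve 6 (λ a b c d v s →
    v :* c :* a :+ ((v :* d :- s) :* c :+ con 0ℚ)
      := ((a :+ d) :* v :- s) :* c) refl a b c d v s
  pencil-mul v s (suc zero) (suc zero) = solve 6 (λ a b c d v s →
    v :* c :* b :+ ((v :* d :- s) :* d :+ con 0ℚ)
      := ((a :+ d) :* v :- s) :* d :- (a :* d :- b :* c) :* v) refl a b c d v s

  pow-mat2 : (u : ℕ → ℚ) (p q : ℚ) → a + d ≡ p → a * d - b * c ≡ q →
    u 0 ≡ 0ℚ → u 1 ≡ 1ℚ → (∀ k → u (suc (suc k)) ≡ p * u (suc k) - q * u k) →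
    ∀ n i j → pow (mat2 a b c d) (suc n) i j ≡ pencil (u (suc n)) (q * u n) i j
  pow-mat2 u p q tr≡p det≡q u₀ u₁ rec zero i j = begin
    pow (mat2 a b c d) 1 i j  ≡⟨ pow-mat2-one i j ⟩
    pencil 1ℚ 0ℚ i j          ≡⟨ cong₂ (λ v s → pencil v s i j) u₁ q*u₀≡0 ⟨
    pencil (u 1) (q * u 0) i j ∎
    where
    q*u₀≡0 : q * u 0 ≡ 0ℚ
    q*u₀≡0 = trans (cong (q *_) u₀) (ℚₚ.*-zeroʳ q)
  pow-mat2 u p q tr≡p det≡q u₀ u₁ rec (suc n) i j = begin
    mul (pow (mat2 a b c d) (suc n)) (mat2 a b c d) i j
      ≡⟨ mul-congˡ (mat2 a b c d) (pow-mat2 u p q tr≡p det≡q u₀ u₁ rec n) i j ⟩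
    mul (pencil (u (suc n)) (q * u n)) (mat2 a b c d) i j
      ≡⟨ pencil-mul (u (suc n)) (q * u n) i j ⟩
    pencil ((a + d) * u (suc n) - q * u n) ((a * d - b * c) * u (suc n)) i j
      ≡⟨ cong₂ (λ p′ q′ → pencil (p′ * u (suc n) - q * u n) (q′ * u (suc n)) i j)
               tr≡p det≡q ⟩
    pencil (p * u (suc n) - q * u n) (q * u (suc n)) i j
      ≡⟨ cong (λ v → pencil v (q * u (suc n)) i j) (rec n) ⟨
    pencil (u (suc (suc n))) (q * u (suc n)) i j ∎

  IsIntegral-pencil⇔ : ∀ v s → IsIntegral ((a + d) * v) → IsIntegral s →
    (∀ i j → IsIntegral (pencil v s i j)) ⇔
    (IsIntegral (v * a) × IsIntegral (v * b) × IsIntegral (v * c))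
  IsIntegral-pencil⇔ v s int-trv int-s = mk⇔
    (λ int → subst IsIntegral (solve 2 (λ x s → x :- s :+ s := x) refl (v * a) s)
                   (IsIntegral-+ (int zero zero) int-s)
           , int zero (suc zero)
           , int (suc zero) zero)
    (λ (int-va , int-vb , int-vc) → λ where
      zero zero → IsIntegral-- int-va int-s
      zero (suc zero) → int-vb
      (suc zero) zero → int-vc
      (suc zero) (suc zero) → subst IsIntegral
        (solve 4 (λ a d v s → (a :+ d) :* v :- v :* a :- s := v :* d :- s)
               refl a d v s)
        (IsIntegral-- (IsIntegral-- int-trv int-va) int-s))

  charpoly-at-a-÷-b : ∀ {p q} .{{_ : NonZero b}} → a + d ≡ p → a * d - b * c ≡ q →
    (a * a - p * a + q) ÷ b ≡ - c
  charpoly-at-a-÷-b {p} {q} tr≡p det≡q = begin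
    (a * a - p * a + q) * 1/ b
      ≡⟨ cong₂ (λ p′ q′ → (a * a - p′ * a + q′) * 1/ b) tr≡p det≡q ⟨
    (a * a - (a + d) * a + (a * d - b * c)) * 1/ b
      ≡⟨ solve 5 (λ a b c d r → (a :* a :- (a :+ d) :* a :+ (a :* d :- b :* c)) :* r
                    := (:- c) :* (b :* r)) refl a b c d (1/ b) ⟩
    - c * (b * 1/ b)  ≡⟨ cong (- c *_) (ℚₚ.*-inverseʳ b) ⟩
    - c * 1ℚ          ≡⟨ ℚₚ.*-identityʳ (- c) ⟩
    - c               ∎

proposition6p1 : (a b c d : ℚ) (P Q : ℤ) → .{{_ : NonZero b}} →
    a + d ≡ P / 1 → a * d - b * c ≡ Q / 1 → Q ≢ 0ℤ →
    (n : ℕ) → 𝓢 (mat2 a b c d) n ⇔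
    (𝓛 P Q a n × 𝓛 P Q b n × 𝓛 P Q ((a * a - (P / 1) * a + Q / 1) ÷ b) n)
proposition6p1 a b c d P Q tr≡P det≡Q _ zero =
  mk⇔ (λ _ → 𝓛-zero P Q a , 𝓛-zero P Q b , 𝓛-zero P Q ((a * a - ι P * a + ι Q) ÷ b))
      (λ _ → IsIntegral-identity 2)
proposition6p1 a b c d P Q tr≡P det≡Q _ (suc n) =
  ⇔.trans (IsIntegral-entrywise-cong A^[n+1]≡pencil)
  (⇔.trans (IsIntegral-pencil⇔ a b c d v (ι Q * ι (U P Q n)) int-trv int-s)
           (⇔.refl ×-⇔ ⇔.refl ×-⇔ ⇔.sym 𝓛-charpoly⇔𝓛-c))
  where
  v : ℚ
  v = ι (U P Q (suc n))
  A^[n+1]≡pencil : ∀ i j → pow (mat2 a b c d) (suc n) i j ≡ pencil a b c d v (ι Q * ι (U P Q n)) i j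
  A^[n+1]≡pencil = pow-mat2 a b c d (ι ∘ U P Q) (ι P) (ι Q) tr≡P det≡Q refl refl (U-rec P Q) n
  int-trv : IsIntegral ((a + d) * v)
  int-trv = subst IsIntegral (cong (_* v) (sym tr≡P))
                  (IsIntegral-* (IsIntegral-ι P) (IsIntegral-ι (U P Q (suc n))))
  int-s : IsIntegral (ι Q * ι (U P Q n))
  int-s = IsIntegral-* (IsIntegral-ι Q) (IsIntegral-ι (U P Q n))
  𝓛-charpoly⇔𝓛-c : 𝓛 P Q ((a * a - ι P * a + ι Q) ÷ b) (suc n) ⇔ 𝓛 P Q c (suc n)
  𝓛-charpoly⇔𝓛-c = subst (λ X → 𝓛 P Q X (suc n) ⇔ 𝓛 P Q c (suc n))
    (sym (charpoly-at-a-÷-b a b c d tr≡P det≡Q)) (𝓛-neg⇔ P Q c (suc n))
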